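{- Let $G=(K\cup I,E)$ be a split graph and $(V,\mathcal{F})$ the split graph vertex shelling antimatroid defined on $G$. For every feasible set $F\in\mathcal{F}$, there is at most one vertex $i\in I\setminus F$ such that there exists $k\in K\cap F$ with $k$ adjacent to $i$.
   Context: All graphs are finite and simple. A split graph $G=(K\cup I,E)$ has vertex set $V=K\cup I$ partitioned into a clique $K$ and an independent set $I$ (either may be empty), the partition being given. A vertex is simplicial if its neighbours induce a clique. The split graph vertex shelling antimatroid $(V,\mathcal{F})$ on $G$: $F\subseteq V$ is feasible iff there is an ordering $(f_1,\dots,f_{|F|})$ of $F$ such that each $f_j$ is simplicial in $G\setminus\{f_1,\dots,f_{j-1}\}$. -}

module Defs where

open import Data.Nat using (ℕ)
open import Data.Fin using (Fin)
open import Data.Bool using (Bool; true; false)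
open import Data.List using (List; []; _∷_)
open import Data.List.Membership.Propositional using (_∈_; _∉_)
open import Data.Product using (Σ; _×_; ∃-syntax)
open import Relation.Binary.PropositionalEquality using (_≡_)
open import Relation.Nullary using (¬_; Dec)
open import Level using (0ℓ)
open import Relation.Binary using (Rel; Symmetric; Irreflexive; Decidable)

record SimpleGraph (n : ℕ) : Set₁ where
  field
    Adj     : Rel (Fin n) 0ℓ
    sym     : Symmetric Adj
    irrefl  : Irreflexive _≡_ Adj
    adj?    : Decidable Adj

-- A split graph: a simple graph together with a given partition V = K ∪ I,
-- encoded by inK : a vertex v is in K iff inK v ≡ true, in I iff inK v ≡ false.
record SplitGraph (n : ℕ) : Set₁ where
  field
    graph : SimpleGraph n
    inK   : Fin n → Bool
  open SimpleGraph graph public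
  field
    K-clique : ∀ u v → inK u ≡ true → inK v ≡ true → ¬ (u ≡ v) → Adj u v
    I-indep  : ∀ u v → inK u ≡ false → inK v ≡ false → ¬ Adj u v

module _ {n : ℕ} (G : SimpleGraph n) where
  open SimpleGraph G

  -- v is simplicial in G \ S (S given as a list of removed vertices; v ∉ S assumed
  -- separately): the neighbours of v in G \ S induce a clique.
  SimplicialIn : List (Fin n) → Fin n → Set
  SimplicialIn S v =
    ∀ u w → u ∉ S → w ∉ S → Adj v u → Adj v w → ¬ (u ≡ w) → Adj u w

  -- A shelling sequence, written in reverse (most recently removed vertex first):
  -- ShellingRev (f_j ∷ ... ∷ f_1 ∷ []) holds iff each f_j is simplicial
  -- in G \ {f_1, ..., f_{j-1}} and is not among f_1, ..., f_{j-1}.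
  data ShellingRev : List (Fin n) → Set where
    []  : ShellingRev []
    _∷_ : ∀ {v S} → (v ∉ S × SimplicialIn S v) → ShellingRev S → ShellingRev (v ∷ S)

  Feasible : (Fin n → Set) → Set
  Feasible F = ∃[ S ] (ShellingRev S × (∀ v → (F v → v ∈ S) × (v ∈ S → F v)))

module Submission where

-- Record a feasible set by a shelling sequence S, most
-- recently removed vertex first.  Call an independent vertex i ∉ S *exposed*
-- if some clique vertex k ∈ S is adjacent to i; the theorem says that at most
-- one vertex is exposed.
--   * In any graph, when a vertex k of S was removed it was simplicial, so any
--     two distinct neighbours of k that survive the whole sequence are adjacent
--     (`surviving-neighbours-adjacent`).
--   * In a split graph, let v be the last removed vertex of S and assume v is in
--     the clique.  If an independent survivor j has a clique neighbour k' ∈ S,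
--     then v is adjacent to j: either k' = v, or k' was removed while v was
--     still present, and v, j are surviving neighbours of k' (`last-clique-vertex-sees`).
--   * Induction on S: if neither witness of two exposed vertices i, j is the last
--     removed vertex, recurse; otherwise that last vertex v is in the clique and
--     adjacent to both i and j, and simpliciality of v forces Adj i j, which
--     the independence of I forbids unless i = j (`exposed-unique`).

open import Defs
open import Data.Nat using (ℕ)
open import Data.Fin using (Fin; _≟_)
open import Data.Bool using (true; false)
open import Data.List using (List; _∷_)
open import Data.List.Relation.Unary.Any using (here; there)
open import Data.List.Membership.Propositional using (_∈_; _∉_)
open import Data.Product using (_×_; ∃-syntax; _,_; proj₁; proj₂)
open import Data.Empty using (⊥-elim)
open import Relation.Binary.PropositionalEquality using (_≡_; _≢_; refl; sym; trans)
open import Relation.Nullary using (¬_; yes; no)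

∉-tail : ∀ {n} {x v : Fin n} {S : List (Fin n)} → v ∉ x ∷ S → v ∉ S
∉-tail v∉ v∈ = v∉ (there v∈)

module _ {n : ℕ} (G : SimpleGraph n) where
  open SimpleGraph G using (Adj)

  -- Every removed vertex k was simplicial at its removal, and vertices never
  -- removed were present then, so any two distinct surviving neighbours of k
  -- are adjacent.
  surviving-neighbours-adjacent : ∀ {S} → ShellingRev G S →
    ∀ {k u w} → k ∈ S → u ∉ S → w ∉ S → Adj k u → Adj k w → u ≢ w → Adj u w
  surviving-neighbours-adjacent ((_ , simplicial) ∷ _) (here refl) u∉ w∉ =
    simplicial _ _ (∉-tail u∉) (∉-tail w∉)
  surviving-neighbours-adjacent (_ ∷ sh) (there k∈) u∉ w∉ =
    surviving-neighbours-adjacent sh k∈ (∉-tail u∉) (∉-tail w∉)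

module _ {n : ℕ} (G : SplitGraph n) where
  open SplitGraph G hiding (sym)

  clique≢indep : ∀ {k i} → inK k ≡ true → inK i ≡ false → k ≢ i
  clique≢indep k∈K i∈I refl with trans (sym k∈K) i∈I
  ... | ()

  Exposed : List (Fin n) → Fin n → Set
  Exposed S i = inK i ≡ false × i ∉ S × ∃[ k ] (k ∈ S × inK k ≡ true × Adj k i)

  -- If the last removed vertex v is in the clique, it is adjacent to every
  -- vertex exposed by v ∷ S: a witness k' ≠ v was removed while v was present.
  last-clique-vertex-sees : ∀ {v S j} → ShellingRev graph (v ∷ S) → inK v ≡ true →
    Exposed (v ∷ S) j → Adj v j
  last-clique-vertex-sees _ _ (_ , _ , _ , here refl , _ , k'j) = k'j
  last-clique-vertex-sees {v} ((v∉S , _) ∷ sh) v∈K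
    (j∈I , j∉ , k' , there k'∈S , k'∈K , k'j) =
    surviving-neighbours-adjacent graph sh k'∈S v∉S (∉-tail j∉) k'v k'j
      (clique≢indep v∈K j∈I)
    where
      k'v : Adj k' v
      k'v = K-clique k' v k'∈K v∈K (λ { refl → v∉S k'∈S })

  -- If the last removed vertex v is a clique neighbour of an exposed vertex i,
  -- then every other exposed vertex j equals i: v is simplicial with
  -- neighbours i and j, which are not adjacent.
  exposed-by-last : ∀ {v S i j} → ShellingRev graph (v ∷ S) → inK v ≡ true →
    Exposed (v ∷ S) i → Adj v i → Exposed (v ∷ S) j → i ≡ j
  exposed-by-last {i = i} {j} sh@((_ , simplicial) ∷ _) v∈K
    (i∈I , i∉ , _) vi exposed-j@(j∈I , j∉ , _) with i ≟ j
  ... | yes i≡j = i≡j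
  ... | no i≢j = ⊥-elim (I-indep i j i∈I j∈I
          (simplicial i j (∉-tail i∉) (∉-tail j∉) vi
            (last-clique-vertex-sees sh v∈K exposed-j) i≢j))

  exposed-unique : ∀ {S i j} → ShellingRev graph S → Exposed S i → Exposed S j → i ≡ j
  exposed-unique sh exposed-i@(_ , _ , _ , here refl , k∈K , ki) exposed-j =
    exposed-by-last sh k∈K exposed-i ki exposed-j
  exposed-unique sh exposed-i exposed-j@(_ , _ , _ , here refl , k'∈K , k'j) =
    sym (exposed-by-last sh k'∈K exposed-j k'j exposed-i)
  exposed-unique (_ ∷ sh) (i∈I , i∉ , k , there k∈ , k∈K , ki)
                          (j∈I , j∉ , k' , there k'∈ , k'∈K , k'j) =
    exposed-unique sh (i∈I , ∉-tail i∉ , k , k∈ , k∈K , ki)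
                      (j∈I , ∉-tail j∉ , k' , k'∈ , k'∈K , k'j)

mainTheorem3 : ∀ {n : ℕ} (G : SplitGraph n) (F : Fin n → Set) →
    Feasible (SplitGraph.graph G) F →
    ∀ (i j : Fin n) →
    SplitGraph.inK G i ≡ false → ¬ F i →
    (∃[ k ] (SplitGraph.inK G k ≡ true × F k × SplitGraph.Adj G k i)) →
    SplitGraph.inK G j ≡ false → ¬ F j →
    (∃[ k ] (SplitGraph.inK G k ≡ true × F k × SplitGraph.Adj G k j)) →
    i ≡ j
mainTheorem3 G F (S , sh , F≡S) i j i∈I i∉F (k , k∈K , k∈F , ki)
                                    j∈I j∉F (k' , k'∈K , k'∈F , k'j) =
  exposed-unique G sh (exposed i∈I i∉F k∈K k∈F ki) (exposed j∈I j∉F k'∈K k'∈F k'j)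
  where
    exposed : ∀ {u k} → SplitGraph.inK G u ≡ false → ¬ F u →
      SplitGraph.inK G k ≡ true → F k → SplitGraph.Adj G k u → Exposed G S u
    exposed {u} {k} u∈I u∉F k∈K k∈F ku =
      u∈I , (λ u∈S → u∉F (proj₂ (F≡S u) u∈S)) , k , proj₁ (F≡S k) k∈F , k∈K , ku
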